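{- For every positive integer $u$, there exists an MK$(2u+1)$ (a Kirkman triple system of order $2u+1$ containing a Steiner triple system of order $u$ as a subdesign) if and only if there exists a Kirkman frame of type $2^u$ which contains as a subdesign a $3$-GDD of type $1^u$ (i.e., a Kirkman frame of type $(1;2)^u$).
   Context: An STS$(v)$ is a set of $v$ points with a set of 3-subsets (blocks) such that each pair of distinct points lies in exactly one block; a KTS$(v)$ is an STS$(v)$ whose blocks partition into parallel classes (partitions of the point set); a subdesign is a subset of points together with a subset of blocks forming an STS on that subset. A 3-GDD of type $g_1^{u_1}\cdots$ on a point set $V$ is a partition of $V$ into groups (with $u_i$ groups of size $g_i$) together with a set of 3-subsets (blocks) each meeting every group in at most one point, such that any two points in different groups lie in exactly one block. A Kirkman frame is a 3-GDD whose blocks can be partitioned into partial parallel classes, each of which is a partition of $V\setminus V_i$ for some group $V_i$. A Kirkman frame of type $h^u$ (groups $V_1,\dots,V_u$, block set $\mathcal{B}$) contains a 3-GDD $\mathcal{D}$ of type $g^u$ (groups $W_1,\dots,W_u$, block set $\mathcal{A}$) as a subdesign if $W_i\subseteq V_i$ for all $i$ and $\mathcal{A}\subseteq\mathcal{B}$; such a frame is said to be of type $(g;h)^u$. -}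

module Defs where

open import Data.Nat using (ℕ; suc; _+_; _*_; _≤_)
open import Data.Fin using (Fin)
open import Data.Fin.Subset using (Subset; _∈_; _⊆_; _∩_; _─_; ⊤; ∣_∣)
open import Data.List using (List; concat; map)
open import Data.List.Membership.Propositional using () renaming (_∈_ to _∈ₗ_)
open import Data.List.Relation.Unary.Unique.Propositional using (Unique)
open import Data.List.Relation.Binary.Permutation.Propositional using (_↭_)
open import Data.Product using (Σ; ∃; ∃-syntax; _×_; proj₁; proj₂)
open import Relation.Binary.PropositionalEquality using (_≡_; _≢_)

-- A block is a subset of the point set Fin n (required to have size 3).
Block : ℕ → Set
Block n = Subset n

Blocks : ℕ → Set
Blocks n = List (Block n)

ExactlyOneBlock : ∀ {n} → Blocks n → Fin n → Fin n → Set
ExactlyOneBlock Bs x y =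
  (∃[ B ] (B ∈ₗ Bs × x ∈ B × y ∈ B)) ×
  (∀ B B' → B ∈ₗ Bs → B' ∈ₗ Bs → x ∈ B → y ∈ B → x ∈ B' → y ∈ B' → B ≡ B')

IsSTS : ∀ {n} → Subset n → Blocks n → Set
IsSTS P Bs =
  Unique Bs ×
  (∀ B → B ∈ₗ Bs → ∣ B ∣ ≡ 3 × B ⊆ P) ×
  (∀ x y → x ∈ P → y ∈ P → x ≢ y → ExactlyOneBlock Bs x y)

IsParallelClassOn : ∀ {n} → Subset n → Blocks n → Set
IsParallelClassOn P C =
  (∀ B → B ∈ₗ C → B ⊆ P) ×
  (∀ x → x ∈ P → ∃[ B ] (B ∈ₗ C × x ∈ B)) ×
  (∀ x B B' → B ∈ₗ C → B' ∈ₗ C → x ∈ B → x ∈ B' → B ≡ B')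

IsKTS : (v : ℕ) → Blocks v → Set
IsKTS v Bs =
  IsSTS ⊤ Bs ×
  ∃[ classes ] ((concat classes ↭ Bs) × (∀ C → C ∈ₗ classes → IsParallelClassOn ⊤ C))

HasSubSTS : ∀ {n} → Blocks n → ℕ → Set
HasSubSTS {n} Bs w =
  ∃[ W ] ∃[ As ] (∣ W ∣ ≡ w × (∀ A → A ∈ₗ As → A ∈ₗ Bs) × IsSTS W As)

-- There exists a KTS(v) containing an STS(w) as a subdesign.
-- MK(2u+1) is  KTSWithSub (2 * u + 1) u.
KTSWithSub : ℕ → ℕ → Set
KTSWithSub v w = ∃[ Bs ] (IsKTS v Bs × HasSubSTS Bs w)

IsGDD : ∀ {n} (P : Subset n) (g u : ℕ) (G : Fin u → Subset n) → Blocks n → Set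
IsGDD {n} P g u G Bs =
  (∀ i → G i ⊆ P) ×
  (∀ x → x ∈ P → ∃[ i ] (x ∈ G i)) ×
  (∀ x i j → x ∈ G i → x ∈ G j → i ≡ j) ×
  (∀ i → ∣ G i ∣ ≡ g) ×
  Unique Bs ×
  (∀ B → B ∈ₗ Bs → ∣ B ∣ ≡ 3 × B ⊆ P × (∀ i → ∣ B ∩ G i ∣ ≤ 1)) ×
  (∀ x y i j → x ∈ G i → y ∈ G j → i ≢ j → ExactlyOneBlock Bs x y)

IsKirkmanFrame : (h u : ℕ) (G : Fin u → Subset (h * u)) → Blocks (h * u) → Set
IsKirkmanFrame h u G Bs =
  IsGDD ⊤ h u G Bs ×
  ∃[ classes ] ((concat (map proj₂ classes) ↭ Bs) ×
    (∀ c → c ∈ₗ classes →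
       IsParallelClassOn (⊤ ─ G (proj₁ c)) (proj₂ c)))

KirkmanFrameSub : (g h u : ℕ) → Set
KirkmanFrameSub g h u =
  ∃[ G ] ∃[ Bs ] (IsKirkmanFrame h u G Bs ×
    ∃[ W ] ∃[ As ] ((∀ i → W i ⊆ G i) × (∀ A → A ∈ₗ As → A ∈ₗ Bs) ×
      ∃[ P ] IsGDD P g u W As))

{-# OPTIONS --safe #-}

-- Given a KTS(2u+1) containing an STS(u) on W, pick a point ∞ outside W. Each parallel class contains
-- exactly one block through ∞ and ∞ lies on u blocks, so there are u classes; deleting ∞, the pairs left
-- by the blocks through ∞ become the u groups of a Kirkman frame of type 2^u whose partial classes are
-- the remaining blocks of each class. W meets each group in at most one point (two would make the block
-- through ∞ a block of the STS(u)), hence, as |W| = u, in exactly one: a sub-GDD of type 1^u.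
-- Conversely, in a Kirkman frame of type (1;2)^u a point of group i lies on u - 1 blocks and on one
-- block of every partial class not missing group i; counting shows that exactly one partial class
-- misses each group (for u ≥ 2), so adding a point ∞ and completing that class by the block
-- {∞} ∪ group i gives a KTS(2u+1), in which the sub-GDD is an STS(u). For u = 1 both sides hold.

module Submission where

open import Defs

open import Data.Nat using (ℕ; zero; suc; pred; _+_; _*_; _≤_; _<_; z≤n; s≤s; >-nonZero)
open import Data.Nat.Properties
open import Data.Fin using (Fin; zero; suc; punchIn; punchOut)
open import Data.Fin.Properties using (punchInᵢ≢i; punchIn-injective; punchOut-punchIn; punchIn-punchOut; ¬∀⟶∃¬)
  renaming (_≟_ to _≟ᶠ_)
open import Data.Fin.Subset
open import Data.Fin.Subset.Properties
open import Data.Vec using (Vec; []; _∷_; lookup; tail; removeAt; here; there)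
open import Data.Vec.Properties using (removeAt-punchOut; []=⇒lookup; lookup⇒[]=)
open import Data.List using (List; []; _∷_; _++_; map; concat; filter; length; tabulate; allFin)
open import Data.List as List using ()
open import Data.List.Properties
  using (filter-++; length-++; map-∘; map-++; concat-map; map-tabulate; length-tabulate; tabulate-lookup;
         filter-none; filter-accept; filter-reject)
open import Data.List.Membership.Propositional using () renaming (_∈_ to _∈ₗ_)
open import Data.List.Membership.Propositional.Properties
  using (∈-map⁺; ∈-map⁻; ∈-lookup; ∈-concat⁺′; ∈-concat⁻; ∈-tabulate⁻; ∈-filter⁺; ∈-filter⁻; ∈-length;
         ∈-allFin; ∈-++⁺ˡ; ∈-++⁺ʳ; ∈-++⁻; ∈-map∘filter⁺; ∈-map∘filter⁻)
open import Data.List.Relation.Unary.All as All using (All)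
open import Data.List.Relation.Unary.All.Properties using ()
  renaming (map⁺ to All-map⁺; ++⁻ˡ to All-++⁻ˡ; ++⁻ʳ to All-++⁻ʳ)
open import Data.List.Relation.Unary.AllPairs as AllPairs using (AllPairs)
open import Data.List.Relation.Unary.AllPairs.Properties using () renaming (map⁺ to AllPairs-map⁺)
open import Data.List.Relation.Unary.Unique.Propositional.Properties using ()
  renaming (allFin⁺ to Unique-allFin⁺; map⁺ to Unique-map⁺; filter⁺ to Unique-filter⁺; ++⁺ to Unique-++⁺)
open import Data.List.Relation.Unary.Any using (here; there; index)
open import Data.List.Relation.Unary.Any.Properties using (lookup-index)
open import Data.List.Relation.Unary.Unique.Propositional using (Unique)
open import Data.List.Relation.Binary.Permutation.Propositional
  using (_↭_; ↭-sym; ↭-trans; ↭-prep; ↭-reflexive; ↭⇒↭ₛ)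
open import Data.List.Relation.Binary.Permutation.Propositional.Properties
  using (↭-length; filter-↭; ∈-resp-↭; ++⁺ˡ; shifts) renaming (map⁺ to ↭-map⁺)
import Data.List.Relation.Binary.Permutation.Setoid.Properties as ↭ₛ
open import Data.Nat.ListAction using (sum)
open import Algebra.Properties.CommutativeMonoid.Sum +-0-commutativeMonoid
  using (sum-cong-≗; ∑-distrib-+; sum-remove; sum-replicate-zero) renaming (sum to ∑)
open import Data.Product using (Σ; ∃-syntax; _×_; _,_; proj₁; proj₂)
open import Data.Sum using (_⊎_; inj₁; inj₂)
open import Relation.Nullary using (¬_; ¬?; yes; no; contradiction)
open import Relation.Nullary.Decidable using (decidable-stable)
open import Relation.Unary using (Pred; Decidable)
open import Relation.Binary.PropositionalEquality
open import Function.Base using (_∘_)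
open import Function.Bundles using (_⇔_; mk⇔)

-- Finite subsets

Disjoint : ∀ {n} → Subset n → Subset n → Set
Disjoint p q = ∀ {x} → x ∈ p → x ∉ q

x∈p─q⇒x∉q : ∀ {n} (p q : Subset n) {x} → x ∈ p ─ q → x ∉ q
x∈p─q⇒x∉q (inside ∷ p) (inside ∷ q) () here
x∈p─q⇒x∉q (outside ∷ p) (inside ∷ q) () here
x∈p─q⇒x∉q (_ ∷ p) (_ ∷ q) (there x∈p─q) (there x∈q) = x∈p─q⇒x∉q p q x∈p─q x∈q

y∈p-x⇒y≢x : ∀ {n} (p : Subset n) {x y} → y ∈ p - x → y ≢ x
y∈p-x⇒y≢x p {x} y∈p-x refl = x∈p─q⇒x∉q p ⁅ x ⁆ y∈p-x (x∈⁅x⁆ x)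

1≤∣p∣⇒Nonempty : ∀ {n} (p : Subset n) → 1 ≤ ∣ p ∣ → Nonempty p
1≤∣p∣⇒Nonempty {n} p 1≤∣p∣ with nonempty? p
... | yes ne = ne
... | no ∄ = contradiction (trans (cong ∣_∣ (Empty-unique ∄)) (∣⊥∣≡0 n)) (≢-sym (<⇒≢ 1≤∣p∣))

∣p∣<n⇒∃∉ : ∀ {n} (p : Subset n) → ∣ p ∣ < n → ∃[ x ] x ∉ p
∣p∣<n⇒∃∉ {n} p ∣p∣<n = ¬∀⟶∃¬ n (_∈ p) (_∈? p) λ all∈ →
  <⇒≢ ∣p∣<n (trans (cong ∣_∣ (⊆-antisym ⊆⊤ (λ {x} _ → all∈ x))) (∣⊤∣≡n n))

subsingleton⇒∣p∣≤1 : ∀ {n} (p : Subset n) → (∀ {x y} → x ∈ p → y ∈ p → x ≡ y) → ∣ p ∣ ≤ 1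
subsingleton⇒∣p∣≤1 {n} p all≡ with nonempty? p
... | yes (x , x∈p) = subst (_ ≤_) (∣⁅x⁆∣≡1 x)
      (p⊆q⇒∣p∣≤∣q∣ λ y∈p → subst (_∈ ⁅ x ⁆) (all≡ x∈p y∈p) (x∈⁅x⁆ x))
... | no ∄ = ≤-trans (≤-reflexive (trans (cong ∣_∣ (Empty-unique ∄)) (∣⊥∣≡0 n))) z≤n

∣p∪q∣≡∣p∣+∣q∣ : ∀ {n} (p q : Subset n) → Disjoint p q → ∣ p ∪ q ∣ ≡ ∣ p ∣ + ∣ q ∣
∣p∪q∣≡∣p∣+∣q∣ [] [] _ = refl
∣p∪q∣≡∣p∣+∣q∣ (inside ∷ p) (inside ∷ q) p#q = contradiction here (p#q here)
∣p∪q∣≡∣p∣+∣q∣ (inside ∷ p) (outside ∷ q) p#q =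
  cong suc (∣p∪q∣≡∣p∣+∣q∣ p q λ x∈p x∈q → p#q (there x∈p) (there x∈q))
∣p∪q∣≡∣p∣+∣q∣ (outside ∷ p) (inside ∷ q) p#q =
  trans (cong suc (∣p∪q∣≡∣p∣+∣q∣ p q λ x∈p x∈q → p#q (there x∈p) (there x∈q))) (sym (+-suc _ _))
∣p∪q∣≡∣p∣+∣q∣ (outside ∷ p) (outside ∷ q) p#q =
  ∣p∪q∣≡∣p∣+∣q∣ p q λ x∈p x∈q → p#q (there x∈p) (there x∈q)

∣p∣≤1⇒subsingleton : ∀ {n} {p : Subset n} → ∣ p ∣ ≤ 1 → ∀ {x y} → x ∈ p → y ∈ p → x ≡ y
∣p∣≤1⇒subsingleton {p = p} ∣p∣≤1 {x} {y} x∈p y∈p with x ≟ᶠ y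
... | yes x≡y = x≡y
... | no x≢y = contradiction (≤-trans 2≤∣p∣ ∣p∣≤1) 1+n≰n
  where
  ⁅x⁆∪⁅y⁆⊆p : ⁅ x ⁆ ∪ ⁅ y ⁆ ⊆ p
  ⁅x⁆∪⁅y⁆⊆p z∈ with x∈p∪q⁻ ⁅ x ⁆ ⁅ y ⁆ z∈
  ... | inj₁ z∈⁅x⁆ = subst (_∈ p) (sym (x∈⁅y⁆⇒x≡y x z∈⁅x⁆)) x∈p
  ... | inj₂ z∈⁅y⁆ = subst (_∈ p) (sym (x∈⁅y⁆⇒x≡y y z∈⁅y⁆)) y∈p
  2≤∣p∣ : 2 ≤ ∣ p ∣
  2≤∣p∣ = begin
    2                     ≡⟨ cong₂ _+_ (∣⁅x⁆∣≡1 x) (∣⁅x⁆∣≡1 y) ⟨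
    ∣ ⁅ x ⁆ ∣ + ∣ ⁅ y ⁆ ∣ ≡⟨ ∣p∪q∣≡∣p∣+∣q∣ ⁅ x ⁆ ⁅ y ⁆ (λ z∈⁅x⁆ z∈⁅y⁆ →
                               x≢y (trans (sym (x∈⁅y⁆⇒x≡y x z∈⁅x⁆)) (x∈⁅y⁆⇒x≡y y z∈⁅y⁆))) ⟨
    ∣ ⁅ x ⁆ ∪ ⁅ y ⁆ ∣     ≤⟨ p⊆q⇒∣p∣≤∣q∣ ⁅x⁆∪⁅y⁆⊆p ⟩
    ∣ p ∣                 ∎
    where open ≤-Reasoning

suc∣p-x∣≡∣p∣ : ∀ {n} (p : Subset n) {x} → x ∈ p → suc ∣ p - x ∣ ≡ ∣ p ∣
suc∣p-x∣≡∣p∣ (inside ∷ p) here = cong (suc ∘ ∣_∣) (p─⊥≡p p)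
suc∣p-x∣≡∣p∣ (inside ∷ p) (there x∈p) = cong suc (suc∣p-x∣≡∣p∣ p x∈p)
suc∣p-x∣≡∣p∣ (outside ∷ p) (there x∈p) = suc∣p-x∣≡∣p∣ p x∈p

∣⊤─p∣+∣p∣≡n : ∀ {n} (p : Subset n) → ∣ ⊤ ─ p ∣ + ∣ p ∣ ≡ n
∣⊤─p∣+∣p∣≡n [] = refl
∣⊤─p∣+∣p∣≡n (inside ∷ p) = trans (+-suc _ _) (cong suc (∣⊤─p∣+∣p∣≡n p))
∣⊤─p∣+∣p∣≡n (outside ∷ p) = cong suc (∣⊤─p∣+∣p∣≡n p)

lookup-removeAt : ∀ {a} {A : Set a} {n} (xs : Vec A (suc n)) i j →
                  lookup (removeAt xs i) j ≡ lookup xs (punchIn i j)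
lookup-removeAt xs i j = trans (cong (lookup (removeAt xs i)) (sym (punchOut-punchIn i)))
                               (removeAt-punchOut xs (punchInᵢ≢i i j ∘ sym))

∈-removeAt⁻ : ∀ {n} (p : Subset (suc n)) i {y} → y ∈ removeAt p i → punchIn i y ∈ p
∈-removeAt⁻ p i {y} y∈ = lookup⇒[]= _ p (trans (sym (lookup-removeAt p i y)) ([]=⇒lookup y∈))

∈-removeAt⁺ : ∀ {n} (p : Subset (suc n)) i {y} → punchIn i y ∈ p → y ∈ removeAt p i
∈-removeAt⁺ p i {y} iy∈ = lookup⇒[]= y (removeAt p i) (trans (lookup-removeAt p i y) ([]=⇒lookup iy∈))

∣removeAt∣-∉ : ∀ {n} (p : Subset (suc n)) {i} → i ∉ p → ∣ removeAt p i ∣ ≡ ∣ p ∣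
∣removeAt∣-∉ (inside ∷ p) {zero} i∉p = contradiction here i∉p
∣removeAt∣-∉ (outside ∷ p) {zero} i∉p = refl
∣removeAt∣-∉ (inside ∷ p@(_ ∷ _)) {suc i} i∉p = cong suc (∣removeAt∣-∉ p (i∉p ∘ there))
∣removeAt∣-∉ (outside ∷ p@(_ ∷ _)) {suc i} i∉p = ∣removeAt∣-∉ p (i∉p ∘ there)

suc∣removeAt∣-∈ : ∀ {n} (p : Subset (suc n)) {i} → i ∈ p → suc ∣ removeAt p i ∣ ≡ ∣ p ∣
suc∣removeAt∣-∈ (inside ∷ p) here = refl
suc∣removeAt∣-∈ (inside ∷ p@(_ ∷ _)) (there i∈p) = cong suc (suc∣removeAt∣-∈ p i∈p)
suc∣removeAt∣-∈ (outside ∷ p@(_ ∷ _)) (there i∈p) = suc∣removeAt∣-∈ p i∈p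

removeAt-injective : ∀ {n} {p q : Subset (suc n)} {i} → i ∉ p → i ∉ q →
                     removeAt p i ≡ removeAt q i → p ≡ q
removeAt-injective {p = p} {q} {i} i∉p i∉q eq = ⊆-antisym (transfer i∉p eq) (transfer i∉q (sym eq))
  where
  transfer : ∀ {r s} → i ∉ r → removeAt r i ≡ removeAt s i → r ⊆ s
  transfer {r} {s} i∉r eq {x} x∈r = subst (_∈ s) (punchIn-punchOut i≢x)
    (∈-removeAt⁻ s i (subst (punchOut i≢x ∈_) eq
      (∈-removeAt⁺ r i (subst (_∈ r) (sym (punchIn-punchOut i≢x)) x∈r))))
    where
    i≢x : i ≢ x
    i≢x refl = i∉r x∈r

-- Lists and counting

module _ {a} {A : Set a} where

  AllPairs-map-on : ∀ {r s} {R : A → A → Set r} {S : A → A → Set s} {xs} →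
                    (∀ {x y} → x ∈ₗ xs → y ∈ₗ xs → R x y → S x y) → AllPairs R xs → AllPairs S xs
  AllPairs-map-on R⇒S AllPairs.[] = AllPairs.[]
  AllPairs-map-on R⇒S (Rx AllPairs.∷ Rxs) =
    All.tabulate (λ y∈ → R⇒S (here refl) (there y∈) (All.lookup Rx y∈))
    AllPairs.∷ AllPairs-map-on (λ x∈ y∈ → R⇒S (there x∈) (there y∈)) Rxs

  Unique-map⁺-on : ∀ {b} {B : Set b} {f : A → B} {xs} →
                   (∀ {x y} → x ∈ₗ xs → y ∈ₗ xs → f x ≡ f y → x ≡ y) → Unique xs → Unique (map f xs)
  Unique-map⁺-on inj = AllPairs-map⁺ ∘ AllPairs-map-on (λ x∈ y∈ x≢y → x≢y ∘ inj x∈ y∈)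

  Unique-resp-↭ : ∀ {xs ys : List A} → xs ↭ ys → Unique xs → Unique ys
  Unique-resp-↭ xs↭ys = ↭ₛ.Unique-resp-↭ (setoid A) (↭⇒↭ₛ xs↭ys)

  length≤1 : ∀ {xs : List A} → Unique xs → (∀ {x y} → x ∈ₗ xs → y ∈ₗ xs → x ≡ y) → length xs ≤ 1
  length≤1 {[]} _ _ = z≤n
  length≤1 {_ ∷ []} _ _ = ≤-refl
  length≤1 {_ ∷ _ ∷ _} ((x≢y All.∷ _) AllPairs.∷ _) all≡ = contradiction (all≡ (here refl) (there (here refl))) x≢y

  sum-map-const : ∀ (f : A → ℕ) {c} xs → (∀ {x} → x ∈ₗ xs → f x ≡ c) → sum (map f xs) ≡ length xs * c
  sum-map-const f [] _ = refl
  sum-map-const f (x ∷ xs) f≡c = cong₂ _+_ (f≡c (here refl)) (sum-map-const f xs (f≡c ∘ there))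

  sum-map≤length : ∀ (f : A → ℕ) xs → (∀ {x} → x ∈ₗ xs → f x ≤ 1) → sum (map f xs) ≤ length xs
  sum-map≤length f [] _ = z≤n
  sum-map≤length f (x ∷ xs) f≤1 = +-mono-≤ (f≤1 (here refl)) (sum-map≤length f xs (f≤1 ∘ there))

  sum-map≡length⇒≡1 : ∀ (f : A → ℕ) xs → sum (map f xs) ≡ length xs → (∀ {x} → x ∈ₗ xs → f x ≤ 1) →
                      ∀ {x} → x ∈ₗ xs → f x ≡ 1
  sum-map≡length⇒≡1 f (y ∷ xs) sum≡ f≤1 (here refl) =
    ≤-antisym (f≤1 (here refl)) (+-cancelʳ-≤ (length xs) 1 (f y) (begin
    suc (length xs)           ≡⟨ sum≡ ⟨
    f y + sum (map f xs)      ≤⟨ +-monoʳ-≤ (f y) (sum-map≤length f xs (f≤1 ∘ there)) ⟩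
    f y + length xs           ∎))
    where open ≤-Reasoning
  sum-map≡length⇒≡1 f (y ∷ xs) sum≡ f≤1 (there x∈xs) =
    sum-map≡length⇒≡1 f xs (+-cancelˡ-≡ 1 _ _ (trans (cong (_+ sum (map f xs)) (sym fy≡1)) sum≡)) (f≤1 ∘ there) x∈xs
    where
    fy≡1 : f y ≡ 1
    fy≡1 = sum-map≡length⇒≡1 f (y ∷ xs) sum≡ f≤1 (here refl)

  Unique-++⁻ : ∀ xs {ys : List A} → Unique (xs ++ ys) → Unique xs × Unique ys × (∀ {x} → x ∈ₗ xs → ¬ x ∈ₗ ys)
  Unique-++⁻ [] u = AllPairs.[] , u , λ ()
  Unique-++⁻ (x ∷ xs) (x∉ AllPairs.∷ u) with Unique-++⁻ xs u
  ... | uxs , uys , xs#ys = All-++⁻ˡ xs x∉ AllPairs.∷ uxs , uys , λ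
    { (here refl) x∈ys → All.lookup (All-++⁻ʳ xs x∉) x∈ys refl
    ; (there z∈xs) z∈ys → xs#ys z∈xs z∈ys }

  Unique-concat⁻ : ∀ {xss : List (List A)} → Unique (concat xss) → ∀ {xs} → xs ∈ₗ xss → Unique xs
  Unique-concat⁻ {xs ∷ _} u (here refl) = proj₁ (Unique-++⁻ xs u)
  Unique-concat⁻ {xs ∷ _} u (there xs∈) = Unique-concat⁻ (proj₁ (proj₂ (Unique-++⁻ xs u))) xs∈

  Unique-concat⇒lookup-injective : ∀ (xss : List (List A)) → Unique (concat xss) →
    ∀ {x} k l → x ∈ₗ List.lookup xss k → x ∈ₗ List.lookup xss l → k ≡ l
  Unique-concat⇒lookup-injective (xs ∷ xss) u zero zero _ _ = refl
  Unique-concat⇒lookup-injective (xs ∷ xss) u zero (suc l) x∈xs x∈l =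
    contradiction (∈-concat⁺′ x∈l (∈-lookup {xs = xss} l)) (proj₂ (proj₂ (Unique-++⁻ xs u)) x∈xs)
  Unique-concat⇒lookup-injective (xs ∷ xss) u (suc k) zero x∈k x∈xs =
    contradiction (∈-concat⁺′ x∈k (∈-lookup {xs = xss} k)) (proj₂ (proj₂ (Unique-++⁻ xs u)) x∈xs)
  Unique-concat⇒lookup-injective (xs ∷ xss) u (suc k) (suc l) x∈k x∈l =
    cong suc (Unique-concat⇒lookup-injective xss (proj₁ (proj₂ (Unique-++⁻ xs u))) k l x∈k x∈l)

  concat-map-∷↭ : ∀ {b} {B : Set b} (f : A → B) (g : A → List B) xs →
                  concat (map (λ x → f x ∷ g x) xs) ↭ map f xs ++ concat (map g xs)
  concat-map-∷↭ f g [] = ↭-reflexive refl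
  concat-map-∷↭ f g (x ∷ xs) = ↭-prep (f x) (↭-trans (++⁺ˡ (g x) (concat-map-∷↭ f g xs)) (shifts (g x) (map f xs)))

  module _ {p} {P : Pred A p} (P? : Decidable P) where

    length-filter-concat : ∀ xss → length (filter P? (concat xss)) ≡ sum (map (length ∘ filter P?) xss)
    length-filter-concat [] = refl
    length-filter-concat (xs ∷ xss) = begin
      length (filter P? (xs ++ concat xss))                   ≡⟨ cong length (filter-++ P? xs (concat xss)) ⟩
      length (filter P? xs ++ filter P? (concat xss))         ≡⟨ length-++ (filter P? xs) ⟩
      length (filter P? xs) + length (filter P? (concat xss))
        ≡⟨ cong (length (filter P? xs) +_) (length-filter-concat xss) ⟩
      length (filter P? xs) + sum (map (length ∘ filter P?) xss) ∎
      where open ≡-Reasoning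

    sum-map-indicator : ∀ (g : A → ℕ) xs → (∀ {x} → x ∈ₗ xs → P x → g x ≡ 0) → (∀ {x} → x ∈ₗ xs → ¬ P x → g x ≡ 1) →
                        length (filter P? xs) + sum (map g xs) ≡ length xs
    sum-map-indicator g [] _ _ = refl
    sum-map-indicator g (x ∷ xs) g≡0 g≡1 with P? x
    ... | yes Px = cong suc (trans (cong (length (filter P? xs) +_) (cong (_+ sum (map g xs)) (g≡0 (here refl) Px)))
                                   (sum-map-indicator g xs (g≡0 ∘ there) (g≡1 ∘ there)))
    ... | no ¬Px = trans (cong (length (filter P? xs) +_) (cong (_+ sum (map g xs)) (g≡1 (here refl) ¬Px)))
                         (trans (+-suc _ _) (cong suc (sum-map-indicator g xs (g≡0 ∘ there) (g≡1 ∘ there))))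

    filter-witness : ∀ xs → 1 ≤ length (filter P? xs) → ∃[ x ] (x ∈ₗ xs × P x)
    filter-witness xs 1≤ with filter P? xs in eq
    ... | x ∷ _ = x , ∈-filter⁻ P? (subst (x ∈ₗ_) (sym eq) (here refl))

∑-indicator : ∀ {u} (j : Fin u) (t : Fin u → ℕ) → t j ≡ 1 → (∀ k → k ≢ j → t k ≡ 0) → ∑ t ≡ 1
∑-indicator {suc u} j t tj≡1 t≡0 = trans (sum-remove {i = j} t)
  (cong₂ _+_ tj≡1 (trans (sum-cong-≗ λ k → t≡0 _ (punchInᵢ≢i j k)) (sum-replicate-zero u)))

∑-const : ∀ {u} c → ∑ {u} (λ _ → c) ≡ u * c
∑-const {zero} c = refl
∑-const {suc u} c = cong (c +_) (∑-const {u} c)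

module _ {a} {X : Set a} {u : ℕ} (f : X → Fin u) where

  fibre : Fin u → List X → ℕ
  fibre i = length ∘ filter (λ x → f x ≟ᶠ i)

  fibre-∷ : ∀ i x xs → fibre i (x ∷ xs) ≡ fibre i (x ∷ []) + fibre i xs
  fibre-∷ i x xs = trans (cong length (filter-++ (λ y → f y ≟ᶠ i) (x ∷ []) xs))
                         (length-++ (filter (λ y → f y ≟ᶠ i) (x ∷ [])))

  ∑-fibre : ∀ xs → ∑ (λ i → fibre i xs) ≡ length xs
  ∑-fibre [] = sum-replicate-zero u
  ∑-fibre (x ∷ xs) = begin
    ∑ (λ i → fibre i (x ∷ xs))                          ≡⟨ sum-cong-≗ (λ i → fibre-∷ i x xs) ⟩
    ∑ (λ i → fibre i (x ∷ []) + fibre i xs)             ≡⟨ ∑-distrib-+ (λ i → fibre i (x ∷ [])) (λ i → fibre i xs) ⟩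
    ∑ (λ i → fibre i (x ∷ [])) + ∑ (λ i → fibre i xs)   ≡⟨ cong₂ _+_ ∑-fibre-singleton (∑-fibre xs) ⟩
    suc (length xs)                                     ∎
    where
    open ≡-Reasoning
    ∑-fibre-singleton : ∑ (λ i → fibre i (x ∷ [])) ≡ 1
    ∑-fibre-singleton = ∑-indicator (f x) _ (cong length (filter-accept (λ y → f y ≟ᶠ f x) refl))
      λ k k≢fx → cong length (filter-reject (λ y → f y ≟ᶠ k) (k≢fx ∘ sym))

  -- all fibres then have the same size c, and u c = c + (u - 1)
  fibre≡1 : 2 ≤ u → ∀ xs → (∀ i → fibre i xs + pred u ≡ length xs) → ∀ i → fibre i xs ≡ 1
  fibre≡1 2≤u xs complement i = *-cancelˡ-≡ c 1 (pred u) {{>-nonZero (pred-mono-≤ 2≤u)}}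
    (+-cancelˡ-≡ c _ _ (begin
      c + pred u * c             ≡⟨ cong (_* c) (suc-pred u {{>-nonZero (≤-trans (s≤s z≤n) 2≤u)}}) ⟩
      u * c                      ≡⟨ ∑-const {u} c ⟨
      ∑ {u} (λ _ → c)            ≡⟨ sum-cong-≗ (λ j → +-cancelʳ-≡ (pred u) _ _
                                                     (trans (complement i) (sym (complement j)))) ⟩
      ∑ (λ j → fibre j xs)       ≡⟨ ∑-fibre xs ⟩
      length xs                  ≡⟨ complement i ⟨
      c + pred u                 ≡⟨ cong (c +_) (*-identityʳ (pred u)) ⟨
      c + pred u * 1             ∎))
    where
    open ≡-Reasoning
    c = fibre i xs

  fibre≤1⇒Unique : ∀ xs → (∀ i → fibre i xs ≤ 1) → Unique (map f xs)
  fibre≤1⇒Unique [] _ = AllPairs.[]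
  fibre≤1⇒Unique (x ∷ xs) fibre≤1 =
    All-map⁺ (All.tabulate λ y∈xs fx≡fy → 1+n≰n (≤-trans (fibre-x∷xs≥2 y∈xs fx≡fy) (fibre≤1 (f x))))
    AllPairs.∷ fibre≤1⇒Unique xs λ i →
      ≤-trans (m≤n+m (fibre i xs) (fibre i (x ∷ []))) (≤-trans (≤-reflexive (sym (fibre-∷ i x xs))) (fibre≤1 i))
    where
    fibre-x∷xs≥2 : ∀ {y} → y ∈ₗ xs → f x ≡ f y → 2 ≤ fibre (f x) (x ∷ xs)
    fibre-x∷xs≥2 y∈xs fx≡fy = subst (2 ≤_) (sym (cong length (filter-accept (λ z → f z ≟ᶠ f x) refl)))
      (s≤s (∈-length (∈-filter⁺ (λ z → f z ≟ᶠ f x) y∈xs (sym fx≡fy))))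

module _ {n : ℕ} where

  ∈-⋃⁺ : ∀ {L : List (Subset n)} {B x} → B ∈ₗ L → x ∈ B → x ∈ ⋃ L
  ∈-⋃⁺ {B ∷ L} (here refl) x∈B = p⊆p∪q (⋃ L) x∈B
  ∈-⋃⁺ {C ∷ L} (there B∈L) x∈B = q⊆p∪q C (⋃ L) (∈-⋃⁺ B∈L x∈B)

  ∈-⋃⁻ : ∀ (L : List (Subset n)) {x} → x ∈ ⋃ L → ∃[ B ] (B ∈ₗ L × x ∈ B)
  ∈-⋃⁻ [] x∈⊥ = contradiction x∈⊥ ∉⊥
  ∈-⋃⁻ (B ∷ L) x∈ with x∈p∪q⁻ B (⋃ L) x∈
  ... | inj₁ x∈B = B , here refl , x∈B
  ... | inj₂ x∈⋃L with ∈-⋃⁻ L x∈⋃L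
  ... | C , C∈L , x∈C = C , there C∈L , x∈C

  ∣⋃∣≡sum : ∀ (L : List (Subset n)) → AllPairs Disjoint L → ∣ ⋃ L ∣ ≡ sum (map ∣_∣ L)
  ∣⋃∣≡sum [] AllPairs.[] = ∣⊥∣≡0 n
  ∣⋃∣≡sum (B ∷ L) (B#L AllPairs.∷ disj) =
    trans (∣p∪q∣≡∣p∣+∣q∣ B (⋃ L) B#⋃L) (cong (∣ B ∣ +_) (∣⋃∣≡sum L disj))
    where
    B#⋃L : Disjoint B (⋃ L)
    B#⋃L x∈B x∈⋃L with ∈-⋃⁻ L x∈⋃L
    ... | C , C∈L , x∈C = All.lookup B#L C∈L x∈B x∈C

  ∣S∣≡sum-partition : ∀ {S : Subset n} (L : List (Subset n)) → AllPairs Disjoint L →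
                      (∀ {B} → B ∈ₗ L → B ⊆ S) → (∀ {x} → x ∈ S → ∃[ B ] (B ∈ₗ L × x ∈ B)) →
                      ∣ S ∣ ≡ sum (map ∣_∣ L)
  ∣S∣≡sum-partition {S} L disj ⊆S cover = trans (cong ∣_∣ S≡⋃L) (∣⋃∣≡sum L disj)
    where
    S≡⋃L : S ≡ ⋃ L
    S≡⋃L = ⊆-antisym (λ x∈S → let B , B∈L , x∈B = cover x∈S in ∈-⋃⁺ B∈L x∈B)
                     (λ x∈⋃L → let B , B∈L , x∈B = ∈-⋃⁻ L x∈⋃L in ⊆S B∈L x∈B)

  ∣S∣≡sum-family : ∀ {k} {S : Subset n} (W : Fin k → Subset n) →
                   (∀ i → W i ⊆ S) → (∀ x → x ∈ S → ∃[ i ] (x ∈ W i)) → (∀ x i j → x ∈ W i → x ∈ W j → i ≡ j) →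
                   ∣ S ∣ ≡ sum (map (∣_∣ ∘ W) (allFin k))
  ∣S∣≡sum-family {k} {S} W ⊆S cover disj = begin
    ∣ S ∣                            ≡⟨ ∣S∣≡sum-partition (map W (allFin k)) disjoint ⊆S′ cover′ ⟩
    sum (map ∣_∣ (map W (allFin k))) ≡⟨ cong sum (map-∘ (allFin k)) ⟨
    sum (map (∣_∣ ∘ W) (allFin k))   ∎
    where
    open ≡-Reasoning
    disjoint : AllPairs Disjoint (map W (allFin k))
    disjoint = AllPairs-map⁺ (AllPairs.map (λ i≢j {x} x∈Wi x∈Wj → i≢j (disj x _ _ x∈Wi x∈Wj)) (Unique-allFin⁺ k))
    ⊆S′ : ∀ {B} → B ∈ₗ map W (allFin k) → B ⊆ S
    ⊆S′ B∈ with ∈-map⁻ W B∈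
    ... | i , _ , refl = ⊆S i
    cover′ : ∀ {x} → x ∈ S → ∃[ B ] (B ∈ₗ map W (allFin k) × x ∈ B)
    cover′ x∈S = let i , x∈Wi = cover _ x∈S in W i , ∈-map⁺ W (∈-allFin i) , x∈Wi

-- Block designs

∣P∣≡u*g : ∀ {n} {P : Subset n} {g u G Bs} → IsGDD P g u G Bs → ∣ P ∣ ≡ u * g
∣P∣≡u*g {P = P} {g} {u} {G} (⊆P , cover , disjoint , size , _) = begin
  ∣ P ∣                          ≡⟨ ∣S∣≡sum-family G ⊆P cover disjoint ⟩
  sum (map (∣_∣ ∘ G) (allFin u)) ≡⟨ sum-map-const (∣_∣ ∘ G) (allFin u) (λ {i} _ → size i) ⟩
  length (allFin u) * g          ≡⟨ cong (_* g) (length-tabulate (λ (i : Fin u) → i)) ⟩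
  u * g                          ∎
  where open ≡-Reasoning

module _ {n} {x y : Fin n} where

  ExactlyOneBlock-sym : ∀ {Bs : Blocks n} → ExactlyOneBlock Bs x y → ExactlyOneBlock Bs y x
  ExactlyOneBlock-sym ((B , B∈ , x∈B , y∈B) , unique) =
    (B , B∈ , y∈B , x∈B) , λ C C′ C∈ C′∈ y∈C x∈C y∈C′ x∈C′ → unique C C′ C∈ C′∈ x∈C y∈C x∈C′ y∈C′

  ExactlyOneBlock-++ˡ : ∀ {Bs Cs : Blocks n} → ExactlyOneBlock Bs x y →
                        (∀ {C} → C ∈ₗ Cs → x ∈ C → y ∉ C) → ExactlyOneBlock (Bs ++ Cs) x y
  ExactlyOneBlock-++ˡ {Bs} {Cs} ((B , B∈ , x∈B , y∈B) , unique) none =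
    (B , ∈-++⁺ˡ B∈ , x∈B , y∈B) , λ C C′ C∈ C′∈ x∈C y∈C x∈C′ y∈C′ →
      unique C C′ (from C∈ x∈C y∈C) (from C′∈ x∈C′ y∈C′) x∈C y∈C x∈C′ y∈C′
    where
    from : ∀ {C} → C ∈ₗ Bs ++ Cs → x ∈ C → y ∈ C → C ∈ₗ Bs
    from C∈ x∈C y∈C with ∈-++⁻ Bs C∈
    ... | inj₁ C∈Bs = C∈Bs
    ... | inj₂ C∈Cs = contradiction y∈C (none C∈Cs x∈C)

  ExactlyOneBlock-++ʳ : ∀ {Bs Cs : Blocks n} → ExactlyOneBlock Cs x y →
                        (∀ {B} → B ∈ₗ Bs → x ∈ B → y ∉ B) → ExactlyOneBlock (Bs ++ Cs) x y
  ExactlyOneBlock-++ʳ {Bs} {Cs} ((C , C∈ , x∈C , y∈C) , unique) none =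
    (C , ∈-++⁺ʳ Bs C∈ , x∈C , y∈C) , λ D D′ D∈ D′∈ x∈D y∈D x∈D′ y∈D′ →
      unique D D′ (from D∈ x∈D y∈D) (from D′∈ x∈D′ y∈D′) x∈D y∈D x∈D′ y∈D′
    where
    from : ∀ {D} → D ∈ₗ Bs ++ Cs → x ∈ D → y ∈ D → D ∈ₗ Cs
    from D∈ x∈D y∈D with ∈-++⁻ Bs D∈
    ... | inj₁ D∈Bs = contradiction y∈D (none D∈Bs x∈D)
    ... | inj₂ D∈Cs = D∈Cs

  ExactlyOneBlock-lift : ∀ {Bs : Blocks n} → ExactlyOneBlock Bs x y →
                         ExactlyOneBlock (map (outside ∷_) Bs) (suc x) (suc y)
  ExactlyOneBlock-lift {Bs} ((B , B∈ , x∈B , y∈B) , unique) =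
    (outside ∷ B , ∈-map⁺ (outside ∷_) B∈ , there x∈B , there y∈B) , unique′
    where
    unique′ : ∀ C C′ → C ∈ₗ map (outside ∷_) Bs → C′ ∈ₗ map (outside ∷_) Bs →
              suc x ∈ C → suc y ∈ C → suc x ∈ C′ → suc y ∈ C′ → C ≡ C′
    unique′ C C′ C∈ C′∈ x∈C y∈C x∈C′ y∈C′ with ∈-map⁻ (outside ∷_) C∈ | ∈-map⁻ (outside ∷_) C′∈
    ... | D , D∈ , refl | D′ , D′∈ , refl =
      cong (outside ∷_) (unique D D′ D∈ D′∈ (drop-there x∈C) (drop-there y∈C) (drop-there x∈C′) (drop-there y∈C′))

IsGDD-1⇒IsSTS : ∀ {n} {P : Subset n} {u W As} → IsGDD P 1 u W As → IsSTS P As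
IsGDD-1⇒IsSTS {P = P} {As = As} (_ , cover , _ , size , uniq , blocks , joined) =
  uniq , (λ A A∈ → let size3 , ⊆P , _ = blocks A A∈ in size3 , ⊆P) , joined′
  where
  joined′ : ∀ x y → x ∈ P → y ∈ P → x ≢ y → ExactlyOneBlock As x y
  joined′ x y x∈P y∈P x≢y with cover x x∈P | cover y y∈P
  ... | i , x∈i | j , y∈j =
    joined x y i j x∈i y∈j λ { refl → x≢y (∣p∣≤1⇒subsingleton (≤-reflexive (size i)) x∈i y∈j) }

IsSTS-lift : ∀ {n} {P : Subset n} {As} → IsSTS P As → IsSTS (outside ∷ P) (map (outside ∷_) As)
IsSTS-lift {P = P} {As} (uniq , blocks , joined) = Unique-map⁺ (λ { refl → refl }) uniq , blocks′ , joined′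
  where
  blocks′ : ∀ A′ → A′ ∈ₗ map (outside ∷_) As → ∣ A′ ∣ ≡ 3 × A′ ⊆ outside ∷ P
  blocks′ A′ A′∈ with ∈-map⁻ (outside ∷_) A′∈
  ... | A , A∈ , refl = proj₁ (blocks A A∈) , λ { (there y∈A) → there (proj₂ (blocks A A∈) y∈A) }
  joined′ : ∀ x y → x ∈ outside ∷ P → y ∈ outside ∷ P → x ≢ y → ExactlyOneBlock (map (outside ∷_) As) x y
  joined′ (suc x) (suc y) (there x∈P) (there y∈P) sx≢sy = ExactlyOneBlock-lift (joined x y x∈P y∈P (sx≢sy ∘ cong suc))

degree : ∀ {n} → Fin n → Blocks n → ℕ
degree x Bs = length (filter (x ∈?_) Bs)

module _ {n} {x : Fin n} where

  degree-↭ : ∀ {Bs Cs : Blocks n} → Bs ↭ Cs → degree x Bs ≡ degree x Cs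
  degree-↭ Bs↭Cs = ↭-length (filter-↭ (x ∈?_) Bs↭Cs)

  degree-concat : ∀ (Bss : List (Blocks n)) → degree x (concat Bss) ≡ sum (map (degree x) Bss)
  degree-concat = length-filter-concat (x ∈?_)

  -- the sets B - x, for the blocks B through x, partition the neighbourhood N of x
  2*degree≡∣N∣ : ∀ {Bs : Blocks n} {N : Subset n} → Unique Bs → (∀ {B} → B ∈ₗ Bs → ∣ B ∣ ≡ 3) → x ∉ N →
                 (∀ {B y} → B ∈ₗ Bs → x ∈ B → y ∈ B → y ≢ x → y ∈ N) →
                 (∀ y → y ∈ N → ExactlyOneBlock Bs x y) →
                 2 * degree x Bs ≡ ∣ N ∣
  2*degree≡∣N∣ {Bs} {N} uniq size3 x∉N N-closed joined = begin
    2 * length F                    ≡⟨ *-comm 2 (length F) ⟩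
    length F * 2                    ≡⟨ sum-map-const (λ B → ∣ B - x ∣) F ∣B-x∣≡2 ⟨
    sum (map (λ B → ∣ B - x ∣) F)        ≡⟨ cong sum (map-∘ F) ⟩
    sum (map ∣_∣ (map (_- x) F))    ≡⟨ ∣S∣≡sum-partition (map (_- x) F) disjoint ⊆N cover ⟨
    ∣ N ∣                           ∎
    where
    open ≡-Reasoning
    F = filter (x ∈?_) Bs
    ∣B-x∣≡2 : ∀ {B} → B ∈ₗ F → ∣ B - x ∣ ≡ 2
    ∣B-x∣≡2 {B} B∈F = let B∈Bs , x∈B = ∈-filter⁻ (x ∈?_) B∈F in
      suc-injective (trans (suc∣p-x∣≡∣p∣ B x∈B) (size3 B∈Bs))
    disjoint : AllPairs Disjoint (map (_- x) F)
    disjoint = AllPairs-map⁺ (AllPairs-map-on B-x#B′-x (Unique-filter⁺ (x ∈?_) uniq))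
      where
      B-x#B′-x : ∀ {B B′} → B ∈ₗ F → B′ ∈ₗ F → B ≢ B′ → Disjoint (B - x) (B′ - x)
      B-x#B′-x {B} {B′} B∈F B′∈F B≢B′ {y} y∈B-x y∈B′-x =
        let B∈Bs , x∈B = ∈-filter⁻ (x ∈?_) B∈F
            B′∈Bs , x∈B′ = ∈-filter⁻ (x ∈?_) B′∈F
            y∈B = p─q⊆p B ⁅ x ⁆ y∈B-x
        in B≢B′ (proj₂ (joined y (N-closed B∈Bs x∈B y∈B (y∈p-x⇒y≢x B y∈B-x)))
                   B B′ B∈Bs B′∈Bs x∈B y∈B x∈B′ (p─q⊆p B′ ⁅ x ⁆ y∈B′-x))
    ⊆N : ∀ {C} → C ∈ₗ map (_- x) F → C ⊆ N
    ⊆N C∈ y∈C with ∈-map⁻ (_- x) C∈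
    ... | B , B∈F , refl = let B∈Bs , x∈B = ∈-filter⁻ (x ∈?_) B∈F in
      N-closed B∈Bs x∈B (p─q⊆p B ⁅ x ⁆ y∈C) (y∈p-x⇒y≢x B y∈C)
    cover : ∀ {y} → y ∈ N → ∃[ C ] (C ∈ₗ map (_- x) F × y ∈ C)
    cover {y} y∈N = let (B , B∈Bs , x∈B , y∈B) , _ = joined y y∈N in
      B - x , ∈-map⁺ (_- x) (∈-filter⁺ (x ∈?_) B∈Bs x∈B) ,
      x∈p∧x≢y⇒x∈p-y y∈B (λ { refl → x∉N y∈N })

  degree-parallelClass-∈ : ∀ {P : Subset n} {C : Blocks n} → IsParallelClassOn P C → Unique C →
                           x ∈ P → degree x C ≡ 1
  degree-parallelClass-∈ {P} {C} (_ , cover , unique) uniq x∈P = ≤-antisym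
    (length≤1 (Unique-filter⁺ (x ∈?_) uniq) λ B∈ B′∈ →
      let B∈C , x∈B = ∈-filter⁻ (x ∈?_) B∈
          B′∈C , x∈B′ = ∈-filter⁻ (x ∈?_) B′∈
      in unique x _ _ B∈C B′∈C x∈B x∈B′)
    (let B , B∈C , x∈B = cover x x∈P in ∈-length (∈-filter⁺ (x ∈?_) B∈C x∈B))

  degree-parallelClass-∉ : ∀ {P : Subset n} {C : Blocks n} → IsParallelClassOn P C → x ∉ P → degree x C ≡ 0
  degree-parallelClass-∉ (⊆P , _ , _) x∉P =
    cong length (filter-none (x ∈?_) (All.tabulate λ B∈C x∈B → x∉P (⊆P _ B∈C x∈B)))

-- KirkmanFrameSub 1 2 u unfolds to FrameWithSubGDD (2 * u) u; the number of groups is kept apart from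
-- the number of points so that it can be transported along an equation
FrameWithSubGDD : ℕ → ℕ → Set
FrameWithSubGDD n k =
  Σ (Fin k → Subset n) λ G → Σ (Blocks n) λ Bs →
    (IsGDD ⊤ 2 k G Bs ×
     Σ (List (Fin k × Blocks n)) λ classes → (concat (map proj₂ classes) ↭ Bs) ×
       (∀ c → c ∈ₗ classes → IsParallelClassOn (⊤ ─ G (proj₁ c)) (proj₂ c))) ×
    Σ (Fin k → Subset n) λ W → Σ (Blocks n) λ As →
      (∀ i → W i ⊆ G i) × (∀ A → A ∈ₗ As → A ∈ₗ Bs) × Σ (Subset n) λ P → IsGDD P 1 k W As

-- From a Kirkman triple system to a Kirkman frame

module PointDeletion {m} (∞ : Fin (suc m)) where

  shrink : Subset (suc m) → Subset m
  shrink B = removeAt B ∞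

  avoids∞? : Decidable (λ (B : Subset (suc m)) → ∞ ∉ B)
  avoids∞? B = ¬? (∞ ∈? B)

  delete : Blocks (suc m) → Blocks m
  delete Bs = map shrink (filter avoids∞? Bs)

  ∈-delete⁻ : ∀ {Bs C} → C ∈ₗ delete Bs → ∃[ B ] (B ∈ₗ Bs × ∞ ∉ B × C ≡ shrink B)
  ∈-delete⁻ C∈ = let B , B∈ , C≡ , ∞∉B = ∈-map∘filter⁻ shrink avoids∞? C∈ in B , B∈ , ∞∉B , C≡

  ∈-delete⁺ : ∀ {Bs B} → B ∈ₗ Bs → ∞ ∉ B → shrink B ∈ₗ delete Bs
  ∈-delete⁺ B∈ ∞∉B = ∈-map∘filter⁺ shrink avoids∞? (_ , B∈ , refl , ∞∉B)

  delete-Unique : ∀ {Bs} → Unique Bs → Unique (delete Bs)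
  delete-Unique {Bs} uniq = Unique-map⁺-on
    (λ B∈ C∈ → removeAt-injective (proj₂ (∈-filter⁻ avoids∞? {xs = Bs} B∈))
                                  (proj₂ (∈-filter⁻ avoids∞? {xs = Bs} C∈)))
    (Unique-filter⁺ avoids∞? uniq)

  delete-↭ : ∀ {Bs Cs} → Bs ↭ Cs → delete Bs ↭ delete Cs
  delete-↭ = ↭-map⁺ shrink ∘ filter-↭ avoids∞?

  delete-concat : ∀ (Bss : List (Blocks (suc m))) → concat (map delete Bss) ≡ delete (concat Bss)
  delete-concat [] = refl
  delete-concat (Bs ∷ Bss) = begin
    delete Bs ++ concat (map delete Bss)                             ≡⟨ cong (delete Bs ++_) (delete-concat Bss) ⟩
    delete Bs ++ delete (concat Bss)                                 ≡⟨ map-++ shrink (filter avoids∞? Bs) _ ⟨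
    map shrink (filter avoids∞? Bs ++ filter avoids∞? (concat Bss))
      ≡⟨ cong (map shrink) (filter-++ avoids∞? Bs (concat Bss)) ⟨
    delete (Bs ++ concat Bss)                                        ∎
    where open ≡-Reasoning

  ExactlyOneBlock-delete : ∀ {Bs y z} → ExactlyOneBlock Bs (punchIn ∞ y) (punchIn ∞ z) →
                           (∀ {B} → B ∈ₗ Bs → punchIn ∞ y ∈ B → punchIn ∞ z ∈ B → ∞ ∉ B) →
                           ExactlyOneBlock (delete Bs) y z
  ExactlyOneBlock-delete {Bs} {y} {z} ((B , B∈ , y∈B , z∈B) , unique) avoids =
    (shrink B , ∈-delete⁺ B∈ (avoids B∈ y∈B z∈B) , ∈-removeAt⁺ B ∞ y∈B , ∈-removeAt⁺ B ∞ z∈B) ,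
    unique′
    where
    unique′ : ∀ C C′ → C ∈ₗ delete Bs → C′ ∈ₗ delete Bs → y ∈ C → z ∈ C → y ∈ C′ → z ∈ C′ → C ≡ C′
    unique′ C C′ C∈ C′∈ y∈C z∈C y∈C′ z∈C′ with ∈-delete⁻ C∈ | ∈-delete⁻ C′∈
    ... | D , D∈ , _ , refl | D′ , D′∈ , _ , refl = cong shrink (unique D D′ D∈ D′∈
      (∈-removeAt⁻ D ∞ y∈C) (∈-removeAt⁻ D ∞ z∈C) (∈-removeAt⁻ D′ ∞ y∈C′) (∈-removeAt⁻ D′ ∞ z∈C′))

  delete-parallelClass : ∀ {C T} → IsParallelClassOn ⊤ C → T ∈ₗ C → ∞ ∈ T →
                         IsParallelClassOn (⊤ ─ shrink T) (delete C)
  delete-parallelClass {C} {T} (_ , cover , unique) T∈C ∞∈T = ⊆⊤─T , cover′ , unique′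
    where
    ≡T : ∀ {B} → B ∈ₗ C → ∞ ∈ B → B ≡ T
    ≡T B∈C ∞∈B = unique ∞ _ T B∈C T∈C ∞∈B ∞∈T
    ⊆⊤─T : ∀ B′ → B′ ∈ₗ delete C → B′ ⊆ ⊤ ─ shrink T
    ⊆⊤─T B′ B′∈ y∈B′ with ∈-delete⁻ B′∈
    ... | B , B∈C , ∞∉B , refl = x∈p∧x∉q⇒x∈p─q ∈⊤ λ y∈T → ∞∉B (subst (∞ ∈_)
      (sym (unique _ B T B∈C T∈C (∈-removeAt⁻ B ∞ y∈B′) (∈-removeAt⁻ T ∞ y∈T))) ∞∈T)
    cover′ : ∀ y → y ∈ ⊤ ─ shrink T → ∃[ B′ ] (B′ ∈ₗ delete C × y ∈ B′)
    cover′ y y∉T with cover (punchIn ∞ y) ∈⊤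
    ... | B , B∈C , y∈B = shrink B , ∈-delete⁺ B∈C ∞∉B , ∈-removeAt⁺ B ∞ y∈B
      where
      ∞∉B : ∞ ∉ B
      ∞∉B ∞∈B = x∈p─q⇒x∉q ⊤ (shrink T) y∉T (∈-removeAt⁺ T ∞ (subst (punchIn ∞ y ∈_) (≡T B∈C ∞∈B) y∈B))
    unique′ : ∀ y B′ B″ → B′ ∈ₗ delete C → B″ ∈ₗ delete C → y ∈ B′ → y ∈ B″ → B′ ≡ B″
    unique′ y B′ B″ B′∈ B″∈ y∈B′ y∈B″ with ∈-delete⁻ B′∈ | ∈-delete⁻ B″∈
    ... | B , B∈ , _ , refl | D , D∈ , _ , refl =
      cong shrink (unique _ B D B∈ D∈ (∈-removeAt⁻ B ∞ y∈B′) (∈-removeAt⁻ D ∞ y∈B″))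

module FrameFromKTS
  {u : ℕ} {Bs : Blocks (suc (2 * u))}
  (uniq : Unique Bs) (size3 : ∀ B → B ∈ₗ Bs → ∣ B ∣ ≡ 3 × B ⊆ ⊤)
  (joined : ∀ x y → x ∈ ⊤ → y ∈ ⊤ → x ≢ y → ExactlyOneBlock Bs x y)
  (classes : List (Blocks (suc (2 * u)))) (classes↭Bs : concat classes ↭ Bs)
  (parallel : ∀ C → C ∈ₗ classes → IsParallelClassOn ⊤ C)
  {W : Subset (suc (2 * u))} {As : Blocks (suc (2 * u))}
  (∣W∣≡u : ∣ W ∣ ≡ u) (As⊆Bs : ∀ A → A ∈ₗ As → A ∈ₗ Bs)
  (uniqA : Unique As) (size3A : ∀ A → A ∈ₗ As → ∣ A ∣ ≡ 3 × A ⊆ W)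
  (joinedA : ∀ x y → x ∈ W → y ∈ W → x ≢ y → ExactlyOneBlock As x y)
  where

  private
    ∃∉W : ∃[ x ] x ∉ W
    ∃∉W = ∣p∣<n⇒∃∉ W (subst (_< suc (2 * u)) (sym ∣W∣≡u) (s≤s (m≤n*m u 2)))

  ∞ : Fin (suc (2 * u))
  ∞ = proj₁ ∃∉W

  ∞∉W : ∞ ∉ W
  ∞∉W = proj₂ ∃∉W

  open PointDeletion ∞

  pin : Fin (2 * u) → Fin (suc (2 * u))
  pin = punchIn ∞

  pin≢∞ : ∀ y → pin y ≢ ∞
  pin≢∞ = punchInᵢ≢i ∞

  pin-injective : ∀ {y z} → y ≢ z → pin y ≢ pin z
  pin-injective y≢z = y≢z ∘ punchIn-injective ∞ _ _

  pair-unique : ∀ {x y B C} → x ≢ y → B ∈ₗ Bs → C ∈ₗ Bs → x ∈ B → y ∈ B → x ∈ C → y ∈ C → B ≡ C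
  pair-unique {x} {y} {B} {C} x≢y = proj₂ (joined x y ∈⊤ ∈⊤ x≢y) B C

  K : ℕ
  K = length classes

  Class : Fin K → Blocks (suc (2 * u))
  Class = List.lookup classes

  Class-parallel : ∀ k → IsParallelClassOn ⊤ (Class k)
  Class-parallel k = parallel (Class k) (∈-lookup k)

  Class⊆Bs : ∀ k {B} → B ∈ₗ Class k → B ∈ₗ Bs
  Class⊆Bs k B∈ = ∈-resp-↭ classes↭Bs (∈-concat⁺′ B∈ (∈-lookup {xs = classes} k))

  Class-same : ∀ k {B C x} → B ∈ₗ Class k → C ∈ₗ Class k → x ∈ B → x ∈ C → B ≡ C
  Class-same k B∈ C∈ x∈B x∈C = proj₂ (proj₂ (Class-parallel k)) _ _ _ B∈ C∈ x∈B x∈C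

  uniq-classes : Unique (concat classes)
  uniq-classes = Unique-resp-↭ (↭-sym classes↭Bs) uniq

  private
    ∞-block : ∀ k → ∃[ B ] (B ∈ₗ Class k × ∞ ∈ B)
    ∞-block k = proj₁ (proj₂ (Class-parallel k)) ∞ ∈⊤

  T : Fin K → Subset (suc (2 * u))
  T k = proj₁ (∞-block k)

  T∈Class : ∀ k → T k ∈ₗ Class k
  T∈Class k = proj₁ (proj₂ (∞-block k))

  ∞∈T : ∀ k → ∞ ∈ T k
  ∞∈T k = proj₂ (proj₂ (∞-block k))

  T∈Bs : ∀ k → T k ∈ₗ Bs
  T∈Bs k = Class⊆Bs k (T∈Class k)

  T-injective : ∀ {k l} → T k ≡ T l → k ≡ l
  T-injective {k} {l} Tk≡Tl = Unique-concat⇒lookup-injective classes uniq-classes k l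
    (T∈Class k) (subst (_∈ₗ Class l) (sym Tk≡Tl) (T∈Class l))

  group : Fin K → Subset (2 * u)
  group k = shrink (T k)

  ∈group⇒T≡ : ∀ {y k B} → y ∈ group k → B ∈ₗ Bs → ∞ ∈ B → pin y ∈ B → T k ≡ B
  ∈group⇒T≡ {y} {k} y∈ B∈ ∞∈B y∈B =
    pair-unique (pin≢∞ y ∘ sym) (T∈Bs k) B∈ (∞∈T k) (∈-removeAt⁻ (T k) ∞ y∈) ∞∈B y∈B

  group-disjoint : ∀ y k l → y ∈ group k → y ∈ group l → k ≡ l
  group-disjoint y k l y∈k y∈l = T-injective (∈group⇒T≡ y∈k (T∈Bs l) (∞∈T l) (∈-removeAt⁻ (T l) ∞ y∈l))

  group-cover : ∀ y → y ∈ ⊤ → ∃[ k ] (y ∈ group k)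
  group-cover y _ with proj₁ (joined ∞ (pin y) ∈⊤ ∈⊤ (pin≢∞ y ∘ sym))
  ... | B , B∈ , ∞∈B , y∈B =
    k , ∈-removeAt⁺ (T k) ∞ (subst (pin y ∈_) (Class-same k B∈k (T∈Class k) ∞∈B (∞∈T k)) y∈B)
    where
    B∈some-class = ∈-concat⁻ classes (∈-resp-↭ (↭-sym classes↭Bs) B∈)
    k = index B∈some-class
    B∈k = lookup-index B∈some-class

  K≡u : K ≡ u
  K≡u = *-cancelˡ-≡ K u 2 (begin
    2 * K                 ≡⟨ cong (2 *_) degree∞≡K ⟨
    2 * degree ∞ Bs       ≡⟨ 2*degree≡∣N∣ uniq (proj₁ ∘ size3 _) (λ ∞∈ → y∈p-x⇒y≢x ⊤ ∞∈ refl)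
                               (λ _ _ _ y≢∞ → x∈p∧x≢y⇒x∈p-y ∈⊤ y≢∞)
                               (λ y y∈ → joined ∞ y ∈⊤ ∈⊤ (y∈p-x⇒y≢x ⊤ y∈ ∘ sym)) ⟩
    ∣ ⊤ - ∞ ∣             ≡⟨ suc-injective (trans (suc∣p-x∣≡∣p∣ ⊤ {∞} ∈⊤) (∣⊤∣≡n (suc (2 * u)))) ⟩
    2 * u                 ∎)
    where
    open ≡-Reasoning
    degree∞≡K : degree ∞ Bs ≡ K
    degree∞≡K = begin
      degree ∞ Bs                       ≡⟨ degree-↭ classes↭Bs ⟨
      degree ∞ (concat classes)         ≡⟨ degree-concat classes ⟩
      sum (map (degree ∞) classes)
        ≡⟨ sum-map-const (degree ∞) classes (λ C∈ →
             degree-parallelClass-∈ (parallel _ C∈) (Unique-concat⁻ uniq-classes C∈) ∈⊤) ⟩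
      K * 1                             ≡⟨ *-identityʳ K ⟩
      K                                 ∎

  blocks : Blocks (2 * u)
  blocks = delete Bs

  group-size : ∀ k → ∣ group k ∣ ≡ 2
  group-size k = suc-injective (trans (suc∣removeAt∣-∈ (T k) (∞∈T k)) (proj₁ (size3 _ (T∈Bs k))))

  two-in-group⇒T : ∀ {B k y z} → B ∈ₗ Bs → y ≢ z → y ∈ group k → z ∈ group k →
                   pin y ∈ B → pin z ∈ B → T k ≡ B
  two-in-group⇒T {B} {k} B∈ y≢z y∈k z∈k y∈B z∈B =
    pair-unique (pin-injective y≢z) (T∈Bs k) B∈ (∈-removeAt⁻ (T k) ∞ y∈k) (∈-removeAt⁻ (T k) ∞ z∈k) y∈B z∈B

  frame-blocks : ∀ B′ → B′ ∈ₗ blocks → ∣ B′ ∣ ≡ 3 × B′ ⊆ ⊤ × (∀ k → ∣ B′ ∩ group k ∣ ≤ 1)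
  frame-blocks B′ B′∈ with ∈-delete⁻ B′∈
  ... | B , B∈ , ∞∉B , refl = trans (∣removeAt∣-∉ B ∞∉B) (proj₁ (size3 B B∈)) , ⊆⊤ , λ k →
    subsingleton⇒∣p∣≤1 _ λ {y} {z} y∈ z∈ → let y∈B , y∈k = x∈p∩q⁻ _ _ y∈ ; z∈B , z∈k = x∈p∩q⁻ _ _ z∈ in
      decidable-stable (y ≟ᶠ z) λ y≢z → ∞∉B (subst (∞ ∈_)
        (two-in-group⇒T B∈ y≢z y∈k z∈k (∈-removeAt⁻ B ∞ y∈B) (∈-removeAt⁻ B ∞ z∈B)) (∞∈T k))

  frame-joined : ∀ y z i j → y ∈ group i → z ∈ group j → i ≢ j → ExactlyOneBlock blocks y z
  frame-joined y z i j y∈i z∈j i≢j = ExactlyOneBlock-delete (joined _ _ ∈⊤ ∈⊤ (pin-injective y≢z))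
    λ B∈ y∈B z∈B ∞∈B → i≢j (T-injective (trans (∈group⇒T≡ y∈i B∈ ∞∈B y∈B) (sym (∈group⇒T≡ z∈j B∈ ∞∈B z∈B))))
    where
    y≢z : y ≢ z
    y≢z refl = i≢j (group-disjoint y i j y∈i z∈j)

  frame-GDD : IsGDD ⊤ 2 K group blocks
  frame-GDD = (λ _ → ⊆⊤) , group-cover , group-disjoint , group-size ,
              delete-Unique uniq , frame-blocks , frame-joined

  frame-classes : List (Fin K × Blocks (2 * u))
  frame-classes = tabulate λ k → k , delete (Class k)

  frame-classes↭blocks : concat (map proj₂ frame-classes) ↭ blocks
  frame-classes↭blocks = subst (_↭ blocks) (sym concat≡) (delete-↭ classes↭Bs)
    where
    open ≡-Reasoning
    concat≡ : concat (map proj₂ frame-classes) ≡ delete (concat classes)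
    concat≡ = begin
      concat (map proj₂ frame-classes)          ≡⟨ cong concat (map-tabulate (λ k → k , delete (Class k)) proj₂) ⟩
      concat (tabulate (delete ∘ Class))        ≡⟨ cong concat (map-tabulate Class delete) ⟨
      concat (map delete (tabulate Class))      ≡⟨ cong (concat ∘ map delete) (tabulate-lookup classes) ⟩
      concat (map delete classes)               ≡⟨ delete-concat classes ⟩
      delete (concat classes)                   ∎

  frame-parallel : ∀ c → c ∈ₗ frame-classes → IsParallelClassOn (⊤ ─ group (proj₁ c)) (proj₂ c)
  frame-parallel c c∈ with ∈-tabulate⁻ c∈
  ... | k , refl = delete-parallelClass (Class-parallel k) (T∈Class k) (∞∈T k)

  subgroup : Fin K → Subset (2 * u)
  subgroup k = shrink (T k ∩ W)

  subgroup⊆group : ∀ k → subgroup k ⊆ group k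
  subgroup⊆group k y∈ = ∈-removeAt⁺ (T k) ∞ (proj₁ (x∈p∩q⁻ (T k) W (∈-removeAt⁻ (T k ∩ W) ∞ y∈)))

  subgroup⊆shrinkW : ∀ k → subgroup k ⊆ shrink W
  subgroup⊆shrinkW k y∈ = ∈-removeAt⁺ W ∞ (proj₂ (x∈p∩q⁻ (T k) W (∈-removeAt⁻ (T k ∩ W) ∞ y∈)))

  subgroup-cover : ∀ y → y ∈ shrink W → ∃[ k ] (y ∈ subgroup k)
  subgroup-cover y y∈W = let k , y∈k = group-cover y ∈⊤ in
    k , ∈-removeAt⁺ (T k ∩ W) ∞ (x∈p∩q⁺ (∈-removeAt⁻ (T k) ∞ y∈k , ∈-removeAt⁻ W ∞ y∈W))

  subgroup-disjoint : ∀ y k l → y ∈ subgroup k → y ∈ subgroup l → k ≡ l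
  subgroup-disjoint y k l y∈k y∈l = group-disjoint y k l (subgroup⊆group k y∈k) (subgroup⊆group l y∈l)

  ∞∉As : ∀ {A} → A ∈ₗ As → ∞ ∉ A
  ∞∉As A∈ ∞∈A = ∞∉W (proj₂ (size3A _ A∈) ∞∈A)

  ∣subgroup∣≤1 : ∀ k → ∣ subgroup k ∣ ≤ 1
  ∣subgroup∣≤1 k = subsingleton⇒∣p∣≤1 (subgroup k) λ {y} {z} y∈ z∈ →
    decidable-stable (y ≟ᶠ z) λ y≢z →
      let (A , A∈ , y∈A , z∈A) , _ = joinedA (pin y) (pin z) (pinW y∈) (pinW z∈) (pin-injective y≢z)
      in ∞∉As A∈ (subst (∞ ∈_) (two-in-group⇒T (As⊆Bs A A∈) y≢z
                   (subgroup⊆group k y∈) (subgroup⊆group k z∈) y∈A z∈A) (∞∈T k))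
    where
    pinW : ∀ {y} → y ∈ subgroup k → pin y ∈ W
    pinW y∈ = ∈-removeAt⁻ W ∞ (subgroup⊆shrinkW k y∈)

  ∣subgroup∣≡1 : ∀ k → ∣ subgroup k ∣ ≡ 1
  ∣subgroup∣≡1 k = sum-map≡length⇒≡1 (∣_∣ ∘ subgroup) (allFin K) sum≡K (λ _ → ∣subgroup∣≤1 _) (∈-allFin k)
    where
    open ≡-Reasoning
    sum≡K : sum (map (∣_∣ ∘ subgroup) (allFin K)) ≡ length (allFin K)
    sum≡K = begin
      sum (map (∣_∣ ∘ subgroup) (allFin K))
        ≡⟨ ∣S∣≡sum-family subgroup subgroup⊆shrinkW subgroup-cover subgroup-disjoint ⟨
      ∣ shrink W ∣                          ≡⟨ ∣removeAt∣-∉ W ∞∉W ⟩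
      ∣ W ∣                                 ≡⟨ trans ∣W∣≡u (sym K≡u) ⟩
      K                                     ≡⟨ length-tabulate (λ k → k) ⟨
      length (allFin K)                     ∎

  subblocks : Blocks (2 * u)
  subblocks = delete As

  subblocks⊆blocks : ∀ A′ → A′ ∈ₗ subblocks → A′ ∈ₗ blocks
  subblocks⊆blocks A′ A′∈ with ∈-delete⁻ A′∈
  ... | A , A∈ , ∞∉A , refl = ∈-delete⁺ (As⊆Bs A A∈) ∞∉A

  sub-blocks : ∀ A′ → A′ ∈ₗ subblocks → ∣ A′ ∣ ≡ 3 × A′ ⊆ shrink W × (∀ k → ∣ A′ ∩ subgroup k ∣ ≤ 1)
  sub-blocks A′ A′∈ with ∈-delete⁻ A′∈
  ... | A , A∈ , ∞∉A , refl = trans (∣removeAt∣-∉ A ∞∉A) (proj₁ (size3A A A∈)) ,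
    (λ y∈ → ∈-removeAt⁺ W ∞ (proj₂ (size3A A A∈) (∈-removeAt⁻ A ∞ y∈))) ,
    λ k → ≤-trans (∣p∩q∣≤∣q∣ (shrink A) (subgroup k)) (∣subgroup∣≤1 k)

  sub-joined : ∀ y z i j → y ∈ subgroup i → z ∈ subgroup j → i ≢ j → ExactlyOneBlock subblocks y z
  sub-joined y z i j y∈i z∈j i≢j = ExactlyOneBlock-delete
    (joinedA _ _ (∈-removeAt⁻ W ∞ (subgroup⊆shrinkW i y∈i)) (∈-removeAt⁻ W ∞ (subgroup⊆shrinkW j z∈j))
             (pin-injective y≢z))
    (λ A∈ _ _ → ∞∉As A∈)
    where
    y≢z : y ≢ z
    y≢z refl = i≢j (subgroup-disjoint y i j y∈i z∈j)

  sub-GDD : IsGDD (shrink W) 1 K subgroup subblocks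
  sub-GDD = subgroup⊆shrinkW , subgroup-cover , subgroup-disjoint , ∣subgroup∣≡1 ,
            delete-Unique uniqA , sub-blocks , sub-joined

  frameWithSub : FrameWithSubGDD (2 * u) K
  frameWithSub = group , blocks , (frame-GDD , frame-classes , frame-classes↭blocks , frame-parallel) ,
                 subgroup , subblocks , subgroup⊆group , subblocks⊆blocks , shrink W , sub-GDD

-- From a Kirkman frame to a Kirkman triple system

module KTSFromFrame
  {u : ℕ} (2≤u : 2 ≤ u) {G : Fin u → Subset (2 * u)} {Bs : Blocks (2 * u)}
  (G-cover : ∀ x → x ∈ ⊤ → ∃[ i ] (x ∈ G i)) (G-disjoint : ∀ x i j → x ∈ G i → x ∈ G j → i ≡ j)
  (G-size : ∀ i → ∣ G i ∣ ≡ 2) (uniq : Unique Bs)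
  (blocks-ok : ∀ B → B ∈ₗ Bs → ∣ B ∣ ≡ 3 × B ⊆ ⊤ × (∀ i → ∣ B ∩ G i ∣ ≤ 1))
  (joined : ∀ x y i j → x ∈ G i → y ∈ G j → i ≢ j → ExactlyOneBlock Bs x y)
  (classes : List (Fin u × Blocks (2 * u))) (classes↭Bs : concat (map proj₂ classes) ↭ Bs)
  (parallel : ∀ c → c ∈ₗ classes → IsParallelClassOn (⊤ ─ G (proj₁ c)) (proj₂ c))
  {W : Fin u → Subset (2 * u)} {As : Blocks (2 * u)} {P : Subset (2 * u)}
  (As⊆Bs : ∀ A → A ∈ₗ As → A ∈ₗ Bs) (sub : IsGDD P 1 u W As)
  where

  groupOf : Fin (2 * u) → Fin u
  groupOf x = proj₁ (G-cover x ∈⊤)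

  ∈groupOf : ∀ x → x ∈ G (groupOf x)
  ∈groupOf x = proj₂ (G-cover x ∈⊤)

  block∩group≤1 : ∀ {B} → B ∈ₗ Bs → ∀ {i x y} → x ∈ B → y ∈ B → x ∈ G i → y ∈ G i → x ≡ y
  block∩group≤1 B∈ {i} x∈B y∈B x∈G y∈G =
    ∣p∣≤1⇒subsingleton (proj₂ (proj₂ (blocks-ok _ B∈)) i) (x∈p∩q⁺ (x∈B , x∈G)) (x∈p∩q⁺ (y∈B , y∈G))

  rep : Fin u → Fin (2 * u)
  rep i = proj₁ (1≤∣p∣⇒Nonempty (G i) (subst (1 ≤_) (sym (G-size i)) (s≤s z≤n)))

  rep∈G : ∀ i → rep i ∈ G i
  rep∈G i = proj₂ (1≤∣p∣⇒Nonempty (G i) (subst (1 ≤_) (sym (G-size i)) (s≤s z≤n)))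

  degree-rep : ∀ i → degree (rep i) Bs ≡ pred u
  degree-rep i = *-cancelˡ-≡ _ _ 2 (+-cancelʳ-≡ 2 _ _ (begin
    2 * degree (rep i) Bs + 2     ≡⟨ cong₂ _+_ 2*degree≡ (sym (G-size i)) ⟩
    ∣ ⊤ ─ G i ∣ + ∣ G i ∣         ≡⟨ ∣⊤─p∣+∣p∣≡n (G i) ⟩
    2 * u                         ≡⟨ cong (2 *_) (suc-pred u {{>-nonZero (≤-trans (s≤s z≤n) 2≤u)}}) ⟨
    2 * suc (pred u)              ≡⟨ *-suc 2 (pred u) ⟩
    2 + 2 * pred u                ≡⟨ +-comm 2 (2 * pred u) ⟩
    2 * pred u + 2                ∎))
    where
    open ≡-Reasoning
    2*degree≡ : 2 * degree (rep i) Bs ≡ ∣ ⊤ ─ G i ∣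
    2*degree≡ = 2*degree≡∣N∣ uniq (proj₁ ∘ blocks-ok _) (λ rep∈N → x∈p─q⇒x∉q ⊤ (G i) rep∈N (rep∈G i))
      (λ B∈ rep∈B y∈B y≢rep → x∈p∧x∉q⇒x∈p─q ∈⊤ λ y∈G → y≢rep (block∩group≤1 B∈ y∈B rep∈B y∈G (rep∈G i)))
      (λ y y∈N → joined (rep i) y i (groupOf y) (rep∈G i) (∈groupOf y)
         λ i≡ → x∈p─q⇒x∉q ⊤ (G i) y∈N (subst (λ k → y ∈ G k) (sym i≡) (∈groupOf y)))

  index-fibre+pred-u : ∀ i → fibre proj₁ i classes + pred u ≡ length classes
  index-fibre+pred-u i = begin
    fibre proj₁ i classes + pred u                 ≡⟨ cong (fibre proj₁ i classes +_) (sym (degree-rep i)) ⟩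
    fibre proj₁ i classes + degree (rep i) Bs      ≡⟨ cong (fibre proj₁ i classes +_) degree≡sum ⟩
    fibre proj₁ i classes + sum (map (degree (rep i) ∘ proj₂) classes)
      ≡⟨ sum-map-indicator (λ c → proj₁ c ≟ᶠ i) (degree (rep i) ∘ proj₂) classes
           (λ {c} c∈ c≡i → degree-parallelClass-∉ (parallel c c∈)
              (λ rep∈ → x∈p─q⇒x∉q ⊤ (G (proj₁ c)) rep∈ (subst (λ k → rep i ∈ G k) (sym c≡i) (rep∈G i))))
           (λ {c} c∈ c≢i → degree-parallelClass-∈ (parallel c c∈) (uniq-class c∈)
              (x∈p∧x∉q⇒x∈p─q ∈⊤ λ rep∈ → c≢i (G-disjoint (rep i) _ _ rep∈ (rep∈G i)))) ⟩
    length classes                                                 ∎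
    where
    open ≡-Reasoning
    uniq-class : ∀ {c} → c ∈ₗ classes → Unique (proj₂ c)
    uniq-class c∈ = Unique-concat⁻ (Unique-resp-↭ (↭-sym classes↭Bs) uniq) (∈-map⁺ proj₂ c∈)
    degree≡sum : degree (rep i) Bs ≡ sum (map (degree (rep i) ∘ proj₂) classes)
    degree≡sum = begin
      degree (rep i) Bs                                  ≡⟨ degree-↭ classes↭Bs ⟨
      degree (rep i) (concat (map proj₂ classes))        ≡⟨ degree-concat (map proj₂ classes) ⟩
      sum (map (degree (rep i)) (map proj₂ classes))     ≡⟨ cong sum (map-∘ classes) ⟨
      sum (map (degree (rep i) ∘ proj₂) classes)         ∎

  index-fibre≡1 : ∀ i → fibre proj₁ i classes ≡ 1
  index-fibre≡1 = fibre≡1 proj₁ 2≤u classes index-fibre+pred-u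

  indices : List (Fin u)
  indices = map proj₁ classes

  uniq-indices : Unique indices
  uniq-indices = fibre≤1⇒Unique proj₁ classes (≤-reflexive ∘ index-fibre≡1)

  ∈indices : ∀ i → i ∈ₗ indices
  ∈indices i with filter-witness (λ c → proj₁ c ≟ᶠ i) classes (≤-reflexive (sym (index-fibre≡1 i)))
  ... | c , c∈ , refl = ∈-map⁺ proj₁ c∈

  lift : Subset (2 * u) → Subset (suc (2 * u))
  lift B = outside ∷ B

  cone : Fin u → Subset (suc (2 * u))
  cone i = inside ∷ G i

  newBlocks : Blocks (suc (2 * u))
  newBlocks = map cone indices ++ map lift Bs

  ∈newBlocks⁻ : ∀ {B} → B ∈ₗ newBlocks → (∃[ i ] B ≡ cone i) ⊎ (∃[ B₀ ] (B₀ ∈ₗ Bs × B ≡ lift B₀))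
  ∈newBlocks⁻ B∈ with ∈-++⁻ (map cone indices) B∈
  ... | inj₁ B∈cones = let i , _ , B≡ = ∈-map⁻ cone B∈cones in inj₁ (i , B≡)
  ... | inj₂ B∈lifts = inj₂ (∈-map⁻ lift B∈lifts)

  cone-injective : ∀ {i j} → cone i ≡ cone j → i ≡ j
  cone-injective {i} {j} eq = G-disjoint (rep i) i j (rep∈G i) (subst (rep i ∈_) (cong tail eq) (rep∈G i))

  cone≢lift : ∀ {i B} → cone i ≢ lift B
  cone≢lift ()

  newBlocks-Unique : Unique newBlocks
  newBlocks-Unique = Unique-++⁺ (Unique-map⁺ cone-injective uniq-indices) (Unique-map⁺ lift-injective uniq)
    λ (c∈ , l∈) → let _ , _ , ≡cone = ∈-map⁻ cone c∈ ; _ , _ , ≡lift = ∈-map⁻ lift l∈ in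
      cone≢lift (trans (sym ≡cone) ≡lift)
    where
    lift-injective : ∀ {B C} → lift B ≡ lift C → B ≡ C
    lift-injective refl = refl

  0∉lift : ∀ {C} → C ∈ₗ map lift Bs → zero ∉ C
  0∉lift C∈ with ∈-map⁻ lift C∈
  ... | _ , _ , refl = λ ()

  newBlocks-size : ∀ B → B ∈ₗ newBlocks → ∣ B ∣ ≡ 3 × B ⊆ ⊤
  newBlocks-size B B∈ with ∈newBlocks⁻ B∈
  ... | inj₁ (i , refl) = cong suc (G-size i) , ⊆⊤
  ... | inj₂ (B₀ , B₀∈ , refl) = proj₁ (blocks-ok B₀ B₀∈) , ⊆⊤

  cones-joined : ∀ {x} b → x ∈ cone (groupOf b) → ExactlyOneBlock (map cone indices) x (suc b)
  cones-joined {x} b x∈ = (cone (groupOf b) , ∈-map⁺ cone (∈indices _) , x∈ , there (∈groupOf b)) ,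
    λ C C′ C∈ C′∈ _ b∈C _ b∈C′ → trans (≡cone C∈ b∈C) (sym (≡cone C′∈ b∈C′))
    where
    ≡cone : ∀ {C} → C ∈ₗ map cone indices → suc b ∈ C → C ≡ cone (groupOf b)
    ≡cone C∈ b∈C with ∈-map⁻ cone C∈
    ... | k , _ , refl = cong cone (G-disjoint b k (groupOf b) (drop-there b∈C) (∈groupOf b))

  newBlocks-joined : ∀ x y → x ≢ y → ExactlyOneBlock newBlocks x y
  newBlocks-joined zero zero 0≢0 = contradiction refl 0≢0
  newBlocks-joined zero (suc b) _ =
    ExactlyOneBlock-++ˡ (cones-joined b here) λ C∈ 0∈C → contradiction 0∈C (0∉lift C∈)
  newBlocks-joined (suc a) zero a≢0 = ExactlyOneBlock-sym (newBlocks-joined zero (suc a) (a≢0 ∘ sym))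
  newBlocks-joined (suc a) (suc b) a≢b with groupOf a ≟ᶠ groupOf b
  ... | yes same = ExactlyOneBlock-++ˡ (cones-joined b (there (subst (λ k → a ∈ G k) same (∈groupOf a))))
    λ C∈ a∈C b∈C → let B₀ , B₀∈ , C≡ = ∈-map⁻ lift C∈ in
      a≢b (cong suc (block∩group≤1 B₀∈ (drop-there (subst (suc a ∈_) C≡ a∈C)) (drop-there (subst (suc b ∈_) C≡ b∈C))
                                     (subst (λ k → a ∈ G k) same (∈groupOf a)) (∈groupOf b)))
  ... | no different = ExactlyOneBlock-++ʳ
    (ExactlyOneBlock-lift (joined a b (groupOf a) (groupOf b) (∈groupOf a) (∈groupOf b) different))
    λ C∈ a∈C b∈C → let k , _ , C≡ = ∈-map⁻ cone C∈ in
      different (trans (G-disjoint a _ k (∈groupOf a) (drop-there (subst (suc a ∈_) C≡ a∈C)))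
                       (G-disjoint b k _ (drop-there (subst (suc b ∈_) C≡ b∈C)) (∈groupOf b)))

  newClass : Fin u × Blocks (2 * u) → Blocks (suc (2 * u))
  newClass (i , C) = cone i ∷ map lift C

  newClasses↭newBlocks : concat (map newClass classes) ↭ newBlocks
  newClasses↭newBlocks = ↭-trans (concat-map-∷↭ (cone ∘ proj₁) (map lift ∘ proj₂) classes)
    (subst (_↭ newBlocks) (sym split) (++⁺ˡ (map cone indices) (↭-map⁺ lift classes↭Bs)))
    where
    open ≡-Reasoning
    split : map (cone ∘ proj₁) classes ++ concat (map (map lift ∘ proj₂) classes)
          ≡ map cone indices ++ map lift (concat (map proj₂ classes))
    split = cong₂ _++_ (map-∘ classes) (begin
      concat (map (map lift ∘ proj₂) classes)         ≡⟨ cong concat (map-∘ classes) ⟩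
      concat (map (map lift) (map proj₂ classes))     ≡⟨ concat-map (map proj₂ classes) ⟩
      map lift (concat (map proj₂ classes))           ∎)

  newClass-parallel : ∀ c → c ∈ₗ classes → IsParallelClassOn ⊤ (newClass c)
  newClass-parallel (i , C) c∈ = (λ _ _ → ⊆⊤) , cover , unique
    where
    C-parallel = parallel (i , C) c∈
    cover : ∀ x → x ∈ ⊤ → ∃[ B ] (B ∈ₗ newClass (i , C) × x ∈ B)
    cover zero _ = cone i , here refl , here
    cover (suc b) _ with b ∈? G i
    ... | yes b∈G = cone i , here refl , there b∈G
    ... | no b∉G = let B , B∈ , b∈B = proj₁ (proj₂ C-parallel) b (x∈p∧x∉q⇒x∈p─q ∈⊤ b∉G) in
      lift B , there (∈-map⁺ lift B∈) , there b∈B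
    cone∉lift : ∀ {B x} → B ∈ₗ map lift C → x ∈ cone i → x ∉ B
    cone∉lift B∈ x∈cone x∈B with ∈-map⁻ lift B∈
    cone∉lift B∈ (there y∈G) (there y∈D) | D , D∈ , refl =
      x∈p─q⇒x∉q ⊤ (G i) (proj₁ C-parallel D D∈ y∈D) y∈G
    unique : ∀ x B B′ → B ∈ₗ newClass (i , C) → B′ ∈ₗ newClass (i , C) → x ∈ B → x ∈ B′ → B ≡ B′
    unique x B B′ (here refl) (here refl) _ _ = refl
    unique x B B′ (here refl) (there B′∈) x∈B x∈B′ = contradiction x∈B′ (cone∉lift B′∈ x∈B)
    unique x B B′ (there B∈) (here refl) x∈B x∈B′ = contradiction x∈B (cone∉lift B∈ x∈B′)
    unique x B B′ (there B∈) (there B′∈) x∈B x∈B′ with ∈-map⁻ lift B∈ | ∈-map⁻ lift B′∈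
    unique (suc y) B B′ (there B∈) (there B′∈) (there y∈D) (there y∈D′) | D , D∈ , refl | D′ , D′∈ , refl =
      cong lift (proj₂ (proj₂ C-parallel) y D D′ D∈ D′∈ y∈D y∈D′)

  newClasses-parallel : ∀ C → C ∈ₗ map newClass classes → IsParallelClassOn ⊤ C
  newClasses-parallel C C∈ with ∈-map⁻ newClass C∈
  ... | c , c∈ , refl = newClass-parallel c c∈

  lifted-As⊆newBlocks : ∀ A′ → A′ ∈ₗ map lift As → A′ ∈ₗ newBlocks
  lifted-As⊆newBlocks A′ A′∈ with ∈-map⁻ lift A′∈
  ... | A , A∈ , refl = ∈-++⁺ʳ (map cone indices) (∈-map⁺ lift (As⊆Bs A A∈))

  ktsWithSub : KTSWithSub (suc (2 * u)) u
  ktsWithSub = newBlocks ,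
    ((newBlocks-Unique , newBlocks-size , λ x y _ _ → newBlocks-joined x y) ,
     map newClass classes , newClasses↭newBlocks , newClasses-parallel) ,
    lift P , map lift As , trans (∣P∣≡u*g sub) (*-identityʳ u) , lifted-As⊆newBlocks , IsSTS-lift (IsGDD-1⇒IsSTS sub)

KTS3⊇STS1 : KTSWithSub 3 1
KTS3⊇STS1 = ⊤ ∷ [] , ((All.[] AllPairs.∷ AllPairs.[] , (λ { B (here refl) → refl , ⊆⊤ }) , joined) ,
                    (⊤ ∷ []) ∷ [] , ↭-reflexive refl , λ { C (here refl) → parallel })
          , ⁅ zero ⁆ , [] , refl , (λ _ ()) , AllPairs.[] , (λ _ ()) , λ x y x∈ y∈ x≢y →
              contradiction (trans (x∈⁅y⁆⇒x≡y zero x∈) (sym (x∈⁅y⁆⇒x≡y zero y∈))) x≢y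
  where
  joined : ∀ x y → x ∈ ⊤ → y ∈ ⊤ → x ≢ y → ExactlyOneBlock (⊤ ∷ []) x y
  joined x y _ _ _ = (⊤ , here refl , ∈⊤ , ∈⊤) , λ { B B′ (here refl) (here refl) _ _ _ _ → refl }
  parallel : IsParallelClassOn ⊤ (⊤ ∷ [])
  parallel = (λ { B (here refl) → ⊆⊤ }) , (λ x _ → ⊤ , here refl , ∈⊤) ,
             λ { x B B′ (here refl) (here refl) _ _ → refl }

KTSWithSub⇒FrameSub : ∀ u → KTSWithSub (suc (2 * u)) u → KirkmanFrameSub 1 2 u
KTSWithSub⇒FrameSub u (Bs , ((uniq , size3 , joined) , classes , classes↭Bs , parallel) ,
                           W , As , ∣W∣≡u , As⊆Bs , uniqA , size3A , joinedA) =
  subst (FrameWithSubGDD (2 * u)) K≡u frameWithSub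
  where open FrameFromKTS uniq size3 joined classes classes↭Bs parallel ∣W∣≡u As⊆Bs uniqA size3A joinedA

FrameSub⇒KTSWithSub : ∀ u → 1 ≤ u → KirkmanFrameSub 1 2 u → KTSWithSub (suc (2 * u)) u
FrameSub⇒KTSWithSub 1 _ _ = KTS3⊇STS1
FrameSub⇒KTSWithSub u@(suc (suc _)) _
  (G , Bs , ((_ , G-cover , G-disjoint , G-size , uniq , blocks-ok , joined) , classes , classes↭Bs , parallel) ,
   W , As , _ , As⊆Bs , P , sub) =
  KTSFromFrame.ktsWithSub (s≤s (s≤s z≤n)) G-cover G-disjoint G-size uniq blocks-ok joined
                          classes classes↭Bs parallel As⊆Bs sub

proposition2p3 : (u : ℕ) → 1 ≤ u → KTSWithSub (2 * u + 1) u ⇔ KirkmanFrameSub 1 2 u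
proposition2p3 u 1≤u = mk⇔
  (KTSWithSub⇒FrameSub u ∘ subst (λ v → KTSWithSub v u) (+-comm (2 * u) 1))
  (subst (λ v → KTSWithSub v u) (+-comm 1 (2 * u)) ∘ FrameSub⇒KTSWithSub u 1≤u)
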